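{- Let $R$ be an integral domain with $\mathrm{char}(R)\neq 2$, $\kappa\in R$, and let $\Phi$ be the reduction map defined below. For any integers $\ell,m,n\geq 0$, the degree of $\Phi(x^\ell y^mz^n)$ is at most $\max\{\ell,m,n\}+\min\{\ell,m,n\}$, with equality if $\ell\equiv m\equiv n\pmod 2$ and $\mathrm{char}(R)=0$. Furthermore $\Phi(x^\ell y^mz^n)$ is an even polynomial if $\ell\equiv m\equiv n\pmod 2$ and an odd polynomial otherwise.
   Context: $\Phi:R[x,y,z]\to R[x]$ is the $R$-linear map defined on monomials by recursion on total degree: for $\ell,m,n\geq1$, $\Phi(x^\ell y^mz^n)=\Phi\big(x^{\ell-1}y^{m-1}z^{n-1}(x^2+y^2+z^2-\kappa)\big)$; for $m,n\ge1$, $\Phi(y^mz^n)=\Phi(2xy^{m-1}z^{n-1})$; for $\ell,n\ge1$, $\Phi(x^\ell z^n)=\Phi(2x^{\ell-1}yz^{n-1})$; for $\ell,m\ge1$, $\Phi(x^\ell y^m)=\Phi(2x^{\ell-1}y^{m-1}z)$; and $\Phi(x^\ell)=x^\ell$, $\Phi(y^m)=x^m$, $\Phi(z^n)=x^n$. -}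

module Defs where

open import Level using (_⊔_)
open import Algebra.Bundles using (CommutativeRing)
open import Data.Nat as ℕ using (ℕ; zero; suc; _≡ᵇ_; _⊔_; _⊓_)
open import Data.Nat.DivMod using (_%_)
open import Data.Bool using (if_then_else_)
open import Data.Sum using (_⊎_)
open import Data.Product using (_×_)
open import Relation.Nullary using (¬_)
open import Relation.Binary.PropositionalEquality using (_≡_)

-- Polynomials in R[x] are represented by their coefficient functions
-- (coefficient of x^i at index i); all statements below only refer to
-- finitely many / tail-vanishing coefficients, so this is harmless.
module _ {c ℓ} (R : CommutativeRing c ℓ) where
  open CommutativeRing R

  Poly : Set c
  Poly = ℕ → Carrier

  fromℕ : ℕ → Carrier
  fromℕ zero    = 0#
  fromℕ (suc n) = 1# + fromℕ n

  IsIntegralDomain : Set (c Level.⊔ ℓ)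
  IsIntegralDomain = ¬ (1# ≈ 0#) × (∀ a b → a * b ≈ 0# → a ≈ 0# ⊎ b ≈ 0#)

  CharNot2 : Set ℓ
  CharNot2 = ¬ (fromℕ 2 ≈ 0#)

  Char0 : Set ℓ
  Char0 = ∀ n → ¬ (fromℕ (suc n) ≈ 0#)

  _⊕_ : Poly → Poly → Poly
  (p ⊕ q) i = p i + q i

  _⊙_ : Carrier → Poly → Poly
  (a ⊙ p) i = a * p i

  ⊖_ : Poly → Poly
  (⊖ p) i = - p i

  zeroP : Poly
  zeroP _ = 0#

  X^ : ℕ → Poly
  X^ k i = if i ≡ᵇ k then 1# else 0#

  DegLE : Poly → ℕ → Set ℓ
  DegLE p d = ∀ i → d ℕ.< i → p i ≈ 0#

  DegEq : Poly → ℕ → Set ℓ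
  DegEq p d = DegLE p d × ¬ (p d ≈ 0#)

  EvenPoly : Poly → Set ℓ
  EvenPoly p = ∀ i → p (1 ℕ.+ 2 ℕ.* i) ≈ 0#

  OddPoly : Poly → Set ℓ
  OddPoly p = ∀ i → p (2 ℕ.* i) ≈ 0#

  -- Φ(x^l y^m z^n), with fuel f; the recursion lowers total degree by
  -- exactly one per step, so fuel = l + m + n suffices (the fuel-0 clause
  -- is only reached for (0,0,0), which is caught by the first clause).
  ΦF : Carrier → ℕ → ℕ → ℕ → ℕ → Poly
  ΦF κ _ l 0 0 = X^ l
  ΦF κ _ 0 m 0 = X^ m
  ΦF κ _ 0 0 n = X^ n
  ΦF κ zero _ _ _ = zeroP
  -- Φ(x^l y^m z^n) = Φ(x^{l-1}y^{m-1}z^{n-1}(x²+y²+z²-κ))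
  ΦF κ (suc f) (suc l) (suc m) (suc n) =
    ((ΦF κ f (suc (suc l)) m n ⊕ ΦF κ f l (suc (suc m)) n)
      ⊕ ΦF κ f l m (suc (suc n)))
    ⊕ (⊖ (κ ⊙ ΦF κ f l m n))
  -- Φ(y^m z^n) = Φ(2 x y^{m-1} z^{n-1})
  ΦF κ (suc f) 0 (suc m) (suc n) = fromℕ 2 ⊙ ΦF κ f 1 m n
  -- Φ(x^l z^n) = Φ(2 x^{l-1} y z^{n-1})
  ΦF κ (suc f) (suc l) 0 (suc n) = fromℕ 2 ⊙ ΦF κ f l 1 n
  -- Φ(x^l y^m) = Φ(2 x^{l-1} y^{m-1} z)
  ΦF κ (suc f) (suc l) (suc m) 0 = fromℕ 2 ⊙ ΦF κ f l m 1

  Φ : Carrier → ℕ → ℕ → ℕ → Poly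
  Φ κ l m n = ΦF κ (l ℕ.+ m ℕ.+ n) l m n

SameParity : ℕ → ℕ → ℕ → Set
SameParity l m n = (l % 2 ≡ m % 2) × (m % 2 ≡ n % 2)

{-# OPTIONS --safe #-}

-- Read (l, m, n) as the monomial x^l y^m z^n and let δ be the max plus the min of the
-- exponents. No rewrite step defining Φ increases δ or changes whether l ≡ m ≡ n (mod 2),
-- and Φ sends the pure powers x^k, y^k, z^k to x^k; so the coefficient of x^j vanishes as
-- soon as no pure power reachable from (l, m, n) has exponent j, which gives the degree bound
-- and the parities. For equal parities every coefficient of x^d with d ≥ δ is a natural
-- multiple of 1: in x^{l+1}y^{m+1}z^{n+1} ↦ x^l y^m z^n (x² + y² + z² − κ) the κ-term lowers δ
-- and raising the largest exponent keeps it, and by parity the two-variable steps keep δ too.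
-- So the coefficient of x^δ is a positive multiple of 1, nonzero in characteristic 0.
module Submission where

open import Algebra.Bundles using (CommutativeRing)
import Algebra.Properties.Ring as RingProperties
import Algebra.Properties.Semiring.Mult as SemiringMult
open import Data.Bool using (true; false; T)
open import Data.Empty using (⊥-elim)
open import Data.Nat as ℕ using (ℕ; zero; suc; _≤_; _<_; _⊔_; _⊓_; z<s; _≡ᵇ_)
open import Data.Nat.Properties using (≤-refl; ≤-trans; <-≤-trans; ≤-<-trans; m≤m+n; m≤n+m; >⇒≢; ≡ᵇ⇒≡; ≡⇒≡ᵇ)
open import Data.Product using (Σ-syntax; _×_; _,_)
open import Data.Sum using (_⊎_; inj₁; inj₂; [_,_]′)
import Data.Sum as Sum
open import Function.Base using (_∘_)
open import Function.Bundles using (Equivalence)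
open import Relation.Nullary using (¬_; contradiction)
open import Relation.Binary.PropositionalEquality as ≡ using (_≡_; _≢_)

open import Defs

module Exponents where
  open import Data.Nat
  open import Data.Nat.DivMod using (_%_; m%n<n; [m+kn]%n≡m%n; m*n%n≡0)
  open import Data.Nat.Properties
  open import Data.Nat.Tactic.RingSolver using (solve-∀)
  open import Function.Bundles using (_⇔_; mk⇔)
  open import Relation.Binary.PropositionalEquality
    using (refl; sym; trans; cong; cong₂; subst; subst₂; module ≡-Reasoning)
  import Algebra.Properties.CommutativeSemigroup as CommSemigroupProperties

  δ : ℕ → ℕ → ℕ → ℕ
  δ l m n = l ⊔ m ⊔ n + l ⊓ m ⊓ n

  module ⊔ = CommSemigroupProperties ⊔-commutativeSemigroup
  module ⊓ = CommSemigroupProperties ⊓-commutativeSemigroup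

  δ-swap₁₂ : ∀ l m n → δ l m n ≡ δ m l n
  δ-swap₁₂ l m n = cong₂ _+_ (⊔.xy∙z≈yx∙z l m n) (⊓.xy∙z≈yx∙z l m n)

  δ-swap₂₃ : ∀ l m n → δ l m n ≡ δ l n m
  δ-swap₂₃ l m n = cong₂ _+_ (⊔.xy∙z≈xz∙y l m n) (⊓.xy∙z≈xz∙y l m n)

  δ-suc : ∀ l m n → δ (suc l) (suc m) (suc n) ≡ 2 + δ l m n
  δ-suc l m n = cong suc (+-suc _ _)

  δ-zero₁ : ∀ m n → δ 0 m n ≡ m ⊔ n
  δ-zero₁ m n = +-identityʳ (m ⊔ n)

  δ-zero₂ : ∀ l n → δ l 0 n ≡ l ⊔ n
  δ-zero₂ l n = trans (δ-swap₁₂ l 0 n) (δ-zero₁ l n)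

  δ-zero₃ : ∀ l m → δ l m 0 ≡ l ⊔ m
  δ-zero₃ l m = trans (δ-swap₂₃ l m 0) (δ-zero₂ l m)

  δ-x^ : ∀ k → δ k 0 0 ≡ k
  δ-x^ k = trans (δ-zero₃ k 0) (⊔-identityʳ k)

  δ-y^ : ∀ k → δ 0 k 0 ≡ k
  δ-y^ k = δ-zero₃ 0 k

  δ-z^ : ∀ k → δ 0 0 k ≡ k
  δ-z^ k = δ-zero₁ 0 k

  δ-lower : ∀ l m n → δ l m n < δ (suc l) (suc m) (suc n)
  δ-lower l m n = subst (δ l m n <_) (sym (δ-suc l m n)) (m<n+m (δ l m n) {2} z<s)

  δ-yz→x-suc : ∀ m n → δ 1 (suc m) (suc n) ≡ δ 0 (2 + m) (2 + n)
  δ-yz→x-suc m n = begin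
    δ 1 (suc m) (suc n)   ≡⟨ δ-suc 0 m n ⟩
    2 + δ 0 m n           ≡⟨ cong (2 +_) (δ-zero₁ m n) ⟩
    2 + (m ⊔ n)           ≡⟨ δ-zero₁ (2 + m) (2 + n) ⟨
    δ 0 (2 + m) (2 + n)   ∎
    where open ≡-Reasoning

  δ-yz→x : ∀ m n → δ 1 m n ≤ δ 0 (suc m) (suc n)
  δ-yz→x zero n = begin
    δ 1 0 n             ≡⟨ δ-zero₂ 1 n ⟩
    1 ⊔ n               ≤⟨ ⊔-lub (s≤s z≤n) (n≤1+n n) ⟩
    suc n               ≡⟨ δ-zero₁ 1 (suc n) ⟨
    δ 0 1 (suc n)       ∎
    where open ≤-Reasoning
  δ-yz→x (suc m) zero = begin
    δ 1 (suc m) 0       ≡⟨ δ-zero₃ 1 (suc m) ⟩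
    suc m               ≤⟨ n≤1+n (suc m) ⟩
    suc (suc m) ⊔ 1     ≡⟨ δ-zero₁ (suc (suc m)) 1 ⟨
    δ 0 (suc (suc m)) 1 ∎
    where open ≤-Reasoning
  δ-yz→x (suc m) (suc n) = ≤-reflexive (δ-yz→x-suc m n)

  δ-xz→y : ∀ l n → δ l 1 n ≤ δ (suc l) 0 (suc n)
  δ-xz→y l n = subst₂ _≤_ (δ-swap₁₂ 1 l n) (δ-swap₁₂ 0 (suc l) (suc n)) (δ-yz→x l n)

  δ-xy→z : ∀ l m → δ l m 1 ≤ δ (suc l) (suc m) 0
  δ-xy→z l m = subst₂ _≤_ (δ-swap₂₃ l 1 m) (δ-swap₂₃ (suc l) 0 (suc m)) (δ-xz→y l m)

  δ-yz→x-≡ : ∀ m n → SameParity 1 m n → δ 0 (suc m) (suc n) ≡ δ 1 m n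
  δ-yz→x-≡ zero    n       (() , _)
  δ-yz→x-≡ (suc m) zero    (p , q) = contradiction (trans p q) 1+n≢0
  δ-yz→x-≡ (suc m) (suc n) _       = sym (δ-yz→x-suc m n)

  δ-xz→y-≡ : ∀ l n → SameParity l 1 n → δ (suc l) 0 (suc n) ≡ δ l 1 n
  δ-xz→y-≡ l n (p , q) =
    subst₂ _≡_ (δ-swap₁₂ 0 (suc l) (suc n)) (δ-swap₁₂ 1 l n) (δ-yz→x-≡ l n (sym p , trans p q))

  δ-xy→z-≡ : ∀ l m → SameParity l m 1 → δ (suc l) (suc m) 0 ≡ δ l m 1
  δ-xy→z-≡ l m (p , q) =
    subst₂ _≡_ (δ-swap₂₃ (suc l) 0 (suc m)) (δ-swap₂₃ l 1 m) (δ-xz→y-≡ l m (trans p q , sym q))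

  ⊔-raiseˡ : ∀ a b → (2 + a) ⊔ b ≤ 2 + (a ⊔ b)
  ⊔-raiseˡ a b = ⊔-monoʳ-≤ (2 + a) (m≤n+m b 2)

  δ-raiseˣ : ∀ l m n → δ (2 + l) m n ≤ δ (suc l) (suc m) (suc n)
  δ-raiseˣ l m zero = begin
    δ (2 + l) m 0         ≡⟨ δ-zero₃ (2 + l) m ⟩
    (2 + l) ⊔ m           ≤⟨ ⊔-raiseˡ l m ⟩
    2 + (l ⊔ m)           ≡⟨ cong (2 +_) (δ-zero₃ l m) ⟨
    2 + δ l m 0           ≡⟨ δ-suc l m 0 ⟨
    δ (suc l) (suc m) 1   ∎
    where open ≤-Reasoning
  δ-raiseˣ l zero (suc n) = begin
    δ (2 + l) 0 (suc n)   ≡⟨ δ-zero₂ (2 + l) (suc n) ⟩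
    (2 + l) ⊔ suc n       ≤⟨ ⊔-raiseˡ l (suc n) ⟩
    2 + (l ⊔ suc n)       ≡⟨ cong (2 +_) (δ-zero₂ l (suc n)) ⟨
    2 + δ l 0 (suc n)     ≡⟨ δ-suc l 0 (suc n) ⟨
    δ (suc l) 1 (2 + n)   ∎
    where open ≤-Reasoning
  δ-raiseˣ zero (suc m) (suc n) =
    subst₂ _≤_ (sym (δ-suc 1 m n)) (sym (δ-suc 0 (suc m) (suc n))) (+-monoʳ-≤ 2 (δ-yz→x m n))
  δ-raiseˣ (suc l) (suc m) (suc n) =
    subst₂ _≤_ (sym (δ-suc (2 + l) m n)) (sym (δ-suc (suc l) (suc m) (suc n))) (+-monoʳ-≤ 2 (δ-raiseˣ l m n))

  δ-raiseʸ : ∀ l m n → δ l (2 + m) n ≤ δ (suc l) (suc m) (suc n)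
  δ-raiseʸ l m n =
    subst₂ _≤_ (δ-swap₁₂ (2 + m) l n) (δ-swap₁₂ (suc m) (suc l) (suc n)) (δ-raiseˣ m l n)

  δ-raiseᶻ : ∀ l m n → δ l m (2 + n) ≤ δ (suc l) (suc m) (suc n)
  δ-raiseᶻ l m n =
    subst₂ _≤_ (δ-swap₂₃ l (2 + n) m) (δ-swap₂₃ (suc l) (suc n) (suc m)) (δ-raiseʸ l n m)

  δ-maxˣ : ∀ {l m n} → m ≤ l → n ≤ l → δ l m n ≡ l + m ⊓ n
  δ-maxˣ {l} {m} {n} m≤l n≤l =
    cong₂ _+_ (trans (cong (_⊔ n) (m≥n⇒m⊔n≡m m≤l)) (m≥n⇒m⊔n≡m n≤l)) (cong (_⊓ n) (m≥n⇒m⊓n≡n m≤l))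

  δ-raise-maxˣ : ∀ {l m n} → m ≤ l → n ≤ l → δ (suc l) (suc m) (suc n) ≡ δ (2 + l) m n
  δ-raise-maxˣ {l} {m} {n} m≤l n≤l = begin
    δ (suc l) (suc m) (suc n) ≡⟨ δ-suc l m n ⟩
    2 + δ l m n               ≡⟨ cong (2 +_) (δ-maxˣ m≤l n≤l) ⟩
    2 + l + m ⊓ n             ≡⟨ δ-maxˣ (m≤n⇒m≤o+n 2 m≤l) (m≤n⇒m≤o+n 2 n≤l) ⟨
    δ (2 + l) m n             ∎
    where open ≡-Reasoning

  δ-raise-maxʸ : ∀ {l m n} → l ≤ m → n ≤ m → δ (suc l) (suc m) (suc n) ≡ δ l (2 + m) n
  δ-raise-maxʸ {l} {m} {n} l≤m n≤m =
    subst₂ _≡_ (δ-swap₁₂ (suc m) (suc l) (suc n)) (δ-swap₁₂ (2 + m) l n) (δ-raise-maxˣ l≤m n≤m)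

  δ-raise-maxᶻ : ∀ {l m n} → l ≤ n → m ≤ n → δ (suc l) (suc m) (suc n) ≡ δ l m (2 + n)
  δ-raise-maxᶻ {l} {m} {n} l≤n m≤n =
    subst₂ _≡_ (δ-swap₂₃ (suc l) (suc n) (suc m)) (δ-swap₂₃ l (2 + n) m) (δ-raise-maxʸ l≤n m≤n)

  δ-raise-max : ∀ l m n → let δ′ = δ (suc l) (suc m) (suc n) in
                (δ′ ≡ δ (2 + l) m n ⊎ δ′ ≡ δ l (2 + m) n) ⊎ δ′ ≡ δ l m (2 + n)
  δ-raise-max l m n with ≤-total m l
  ... | inj₁ m≤l with ≤-total n l
  ...   | inj₁ n≤l = inj₁ (inj₁ (δ-raise-maxˣ m≤l n≤l))
  ...   | inj₂ l≤n = inj₂ (δ-raise-maxᶻ l≤n (≤-trans m≤l l≤n))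
  δ-raise-max l m n | inj₂ l≤m with ≤-total n m
  ...   | inj₁ n≤m = inj₁ (inj₂ (δ-raise-maxʸ l≤m n≤m))
  ...   | inj₂ m≤n = inj₂ (δ-raise-maxᶻ (≤-trans l≤m m≤n) m≤n)

  fuel-xyz→x² : ∀ {l m n f} → suc l + suc m + suc n ≤ suc f → 2 + l + m + n ≤ f
  fuel-xyz→x² {l} {m} {n} fuel = ≤-trans (≤-reflexive (total l m n)) (s≤s⁻¹ fuel)
    where total : ∀ l m n → 2 + l + m + n ≡ l + suc m + suc n
          total = solve-∀

  fuel-xyz→y² : ∀ {l m n f} → suc l + suc m + suc n ≤ suc f → l + (2 + m) + n ≤ f
  fuel-xyz→y² {l} {m} {n} fuel = ≤-trans (≤-reflexive (total l m n)) (s≤s⁻¹ fuel)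
    where total : ∀ l m n → l + (2 + m) + n ≡ l + suc m + suc n
          total = solve-∀

  fuel-xyz→z² : ∀ {l m n f} → suc l + suc m + suc n ≤ suc f → l + m + (2 + n) ≤ f
  fuel-xyz→z² {l} {m} {n} fuel = ≤-trans (≤-reflexive (total l m n)) (s≤s⁻¹ fuel)
    where total : ∀ l m n → l + m + (2 + n) ≡ l + suc m + suc n
          total = solve-∀

  fuel-yz→x : ∀ {m n f} → 0 + suc m + suc n ≤ suc f → 1 + m + n ≤ f
  fuel-yz→x {m} {n} fuel = ≤-trans (≤-reflexive (sym (+-suc m n))) (s≤s⁻¹ fuel)

  fuel-xz→y : ∀ {l n f} → suc l + 0 + suc n ≤ suc f → l + 1 + n ≤ f
  fuel-xz→y {l} {n} fuel = ≤-trans (≤-reflexive (total l n)) (s≤s⁻¹ fuel)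
    where total : ∀ l n → l + 1 + n ≡ l + 0 + suc n
          total = solve-∀

  fuel-xy→z : ∀ {l m f} → suc l + suc m + 0 ≤ suc f → l + m + 1 ≤ f
  fuel-xy→z {l} {m} fuel = ≤-trans (≤-reflexive (total l m)) (s≤s⁻¹ fuel)
    where total : ∀ l m → l + m + 1 ≡ l + suc m + 0
          total = solve-∀

  [1+n]%2≡1∸n%2 : ∀ n → suc n % 2 ≡ 1 ∸ n % 2
  [1+n]%2≡1∸n%2 zero          = refl
  [1+n]%2≡1∸n%2 (suc zero)    = refl
  [1+n]%2≡1∸n%2 (suc (suc n)) = [1+n]%2≡1∸n%2 n

  n%2≤1 : ∀ n → n % 2 ≤ 1
  n%2≤1 n = s≤s⁻¹ (m%n<n n 2)

  m%2≡n%2⇔[1+m]%2≡[1+n]%2 : ∀ m n → m % 2 ≡ n % 2 ⇔ suc m % 2 ≡ suc n % 2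
  m%2≡n%2⇔[1+m]%2≡[1+n]%2 m n = mk⇔
    (λ e → trans ([1+n]%2≡1∸n%2 m) (trans (cong (1 ∸_) e) (sym ([1+n]%2≡1∸n%2 n))))
    (λ e → ∸-cancelˡ-≡ (n%2≤1 m) (n%2≤1 n) (trans (sym ([1+n]%2≡1∸n%2 m)) (trans e ([1+n]%2≡1∸n%2 n))))

  sameParity-suc : ∀ l m n → SameParity (suc l) (suc m) (suc n) ⇔ SameParity l m n
  sameParity-suc l m n = mk⇔
    (λ (p , q) → from (m%2≡n%2⇔[1+m]%2≡[1+n]%2 l m) p , from (m%2≡n%2⇔[1+m]%2≡[1+n]%2 m n) q)
    (λ (p , q) → to (m%2≡n%2⇔[1+m]%2≡[1+n]%2 l m) p , to (m%2≡n%2⇔[1+m]%2≡[1+n]%2 m n) q)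
    where open Equivalence

  [1+2*i]%2≡1 : ∀ i → (1 + 2 * i) % 2 ≡ 1
  [1+2*i]%2≡1 i = trans (cong (λ k → (1 + k) % 2) (*-comm 2 i)) ([m+kn]%n≡m%n 1 i 2)

  [2*i]%2≡0 : ∀ i → (2 * i) % 2 ≡ 0
  [2*i]%2≡0 i = trans (cong (_% 2) (*-comm 2 i)) (m*n%n≡0 i 2)

  k%2≡0⇒1+2*i≢k : ∀ i {k} → k % 2 ≡ 0 → 1 + 2 * i ≢ k
  k%2≡0⇒1+2*i≢k i k%2≡0 refl = 1+n≢0 (trans (sym ([1+2*i]%2≡1 i)) k%2≡0)

  k%2≢0⇒2*i≢k : ∀ i {k} → k % 2 ≢ 0 → 2 * i ≢ k
  k%2≢0⇒2*i≢k i k%2≢0 refl = k%2≢0 ([2*i]%2≡0 i)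

  -- I, read as a set of monomials x^l y^m z^n, is closed under the rewrite steps defining Φ:
  -- xyz→x² is x^{l+1}y^{m+1}z^{n+1} ↦ x^{l+2}y^m z^n, one of the four terms of x² + y² + z² − κ,
  -- and yz→x is y^{m+1}z^{n+1} ↦ 2x y^m z^n.
  record ReductionClosed (I : ℕ → ℕ → ℕ → Set) : Set where
    field
      xyz→x² : ∀ {l m n} → I (suc l) (suc m) (suc n) → I (2 + l) m n
      xyz→y² : ∀ {l m n} → I (suc l) (suc m) (suc n) → I l (2 + m) n
      xyz→z² : ∀ {l m n} → I (suc l) (suc m) (suc n) → I l m (2 + n)
      xyz→κ  : ∀ {l m n} → I (suc l) (suc m) (suc n) → I l m n
      yz→x   : ∀ {m n} → I 0 (suc m) (suc n) → I 1 m n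
      xz→y   : ∀ {l n} → I (suc l) 0 (suc n) → I l 1 n
      xy→z   : ∀ {l m} → I (suc l) (suc m) 0 → I l m 1

  PureIn : (ℕ → ℕ → ℕ → Set) → ℕ → Set
  PureIn I k = I k 0 0 ⊎ I 0 k 0 ⊎ I 0 0 k

  δ≤-closed : ∀ d → ReductionClosed (λ l m n → δ l m n ≤ d)
  δ≤-closed d = record
    { xyz→x² = λ {l m n} → ≤-trans (δ-raiseˣ l m n)
    ; xyz→y² = λ {l m n} → ≤-trans (δ-raiseʸ l m n)
    ; xyz→z² = λ {l m n} → ≤-trans (δ-raiseᶻ l m n)
    ; xyz→κ  = λ {l m n} → ≤-trans (<⇒≤ (δ-lower l m n))
    ; yz→x   = λ {m n} → ≤-trans (δ-yz→x m n)
    ; xz→y   = λ {l n} → ≤-trans (δ-xz→y l n)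
    ; xy→z   = λ {l m} → ≤-trans (δ-xy→z l m)
    }

  δ≤-pure : ∀ {d k} → PureIn (λ l m n → δ l m n ≤ d) k → k ≤ d
  δ≤-pure {d} {k} (inj₁ h)        = subst (_≤ d) (δ-x^ k) h
  δ≤-pure {d} {k} (inj₂ (inj₁ h)) = subst (_≤ d) (δ-y^ k) h
  δ≤-pure {d} {k} (inj₂ (inj₂ h)) = subst (_≤ d) (δ-z^ k) h

  -- (2 + l) % 2 reduces to l % 2 and 0 % 2 to 2 % 2, so every step is an instance of sameParity-suc.
  sameParity-closed : ReductionClosed SameParity
  sameParity-closed = record
    { xyz→x² = λ {l m n} → to (sameParity-suc l m n)
    ; xyz→y² = λ {l m n} → to (sameParity-suc l m n)
    ; xyz→z² = λ {l m n} → to (sameParity-suc l m n)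
    ; xyz→κ  = λ {l m n} → to (sameParity-suc l m n)
    ; yz→x   = λ {m n} → to (sameParity-suc 1 m n)
    ; xz→y   = λ {l n} → to (sameParity-suc l 1 n)
    ; xy→z   = λ {l m} → to (sameParity-suc l m 1)
    }
    where open Equivalence

  ¬sameParity-closed : ReductionClosed (λ l m n → ¬ SameParity l m n)
  ¬sameParity-closed = record
    { xyz→x² = λ {l m n} → descend l m n
    ; xyz→y² = λ {l m n} → descend l m n
    ; xyz→z² = λ {l m n} → descend l m n
    ; xyz→κ  = λ {l m n} → descend l m n
    ; yz→x   = λ {m n} → descend 1 m n
    ; xz→y   = λ {l n} → descend l 1 n
    ; xy→z   = λ {l m} → descend l m 1
    }
    where
    descend : ∀ l m n → ¬ SameParity (suc l) (suc m) (suc n) → ¬ SameParity l m n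
    descend l m n ¬sp = ¬sp ∘ Equivalence.from (sameParity-suc l m n)

  sameParity-pure : ∀ {k} → PureIn SameParity k → k % 2 ≡ 0
  sameParity-pure (inj₁ (p , _))        = p
  sameParity-pure (inj₂ (inj₁ (p , _))) = sym p
  sameParity-pure (inj₂ (inj₂ (_ , q))) = sym q

  ¬sameParity-pure : ∀ {k} → PureIn (λ l m n → ¬ SameParity l m n) k → k % 2 ≢ 0
  ¬sameParity-pure (inj₁ ¬sp)        e = ¬sp (e , refl)
  ¬sameParity-pure (inj₂ (inj₁ ¬sp)) e = ¬sp (sym e , e)
  ¬sameParity-pure (inj₂ (inj₂ ¬sp)) e = ¬sp (refl , sym e)

open Exponents

module _ {c ℓ} (R : CommutativeRing c ℓ) where
  open CommutativeRing R hiding (zero)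
  open RingProperties ring using (-0#≈0#)
  open SemiringMult semiring using (×-homo-1; ×-homo-+; ×1-homo-*) renaming (_×_ to _·_)

  X^-off : ∀ {j k} → j ≢ k → X^ R k j ≈ 0#
  X^-off {j} {k} j≢k with j ≡ᵇ k in j≡ᵇk
  ... | false = refl
  ... | true  = contradiction (≡ᵇ⇒≡ j k (≡.subst T (≡.sym j≡ᵇk) _)) j≢k

  private
    +-vanishes : ∀ {x y} → x ≈ 0# → y ≈ 0# → x + y ≈ 0#
    +-vanishes x≈0 y≈0 = trans (+-cong x≈0 y≈0) (+-identityʳ 0#)

    *-vanishes : ∀ a {x} → x ≈ 0# → a * x ≈ 0#
    *-vanishes a x≈0 = trans (*-congˡ x≈0) (zeroʳ a)

    -‿vanishes : ∀ {x} → x ≈ 0# → - x ≈ 0#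
    -‿vanishes x≈0 = trans (-‿cong x≈0) -0#≈0#

    y≈0⇒x+y≈x : ∀ {x y} → y ≈ 0# → x + y ≈ x
    y≈0⇒x+y≈x y≈0 = trans (+-congˡ y≈0) (+-identityʳ _)

  NatMultiple : Carrier → Set → Set ℓ
  NatMultiple x P = Σ[ N ∈ ℕ ] x ≈ N · 1# × (P → 0 < N)

  natMultiple-weaken : ∀ {x} {P Q : Set} → (Q → P) → NatMultiple x P → NatMultiple x Q
  natMultiple-weaken Q⇒P (N , x≈N , pos) = N , x≈N , pos ∘ Q⇒P

  natMultiple-respects : ∀ {x y P} → x ≈ y → NatMultiple y P → NatMultiple x P
  natMultiple-respects x≈y (N , y≈N , pos) = N , trans x≈y y≈N , pos

  natMultiple-+ : ∀ {x y P Q} → NatMultiple x P → NatMultiple y Q → NatMultiple (x + y) (P ⊎ Q)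
  natMultiple-+ (M , x≈M , posM) (N , y≈N , posN) =
    M ℕ.+ N ,
    trans (+-cong x≈M y≈N) (sym (×-homo-+ 1# M N)) ,
    [ (λ p → <-≤-trans (posM p) (m≤m+n M N)) , (λ q → <-≤-trans (posN q) (m≤n+m N M)) ]′

  natMultiple-double : ∀ {x P} → NatMultiple x P → NatMultiple (2 · 1# * x) P
  natMultiple-double (N , x≈N , pos) =
    2 ℕ.* N , trans (*-congˡ x≈N) (sym (×1-homo-* 2 N)) , λ p → <-≤-trans (pos p) (m≤m+n N _)

  X^-natMultiple : ∀ k d → NatMultiple (X^ R k d) (d ≡ k)
  X^-natMultiple k d with d ≡ᵇ k in d≡ᵇk
  ... | true  = 1 , sym (×-homo-1 1#) , λ _ → z<s
  ... | false = 0 , refl , λ d≡k → ⊥-elim (≡.subst T d≡ᵇk (≡⇒≡ᵇ d k d≡k))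

  fromℕ≡·1# : ∀ n → fromℕ R n ≡ n · 1#
  fromℕ≡·1# zero    = ≡.refl
  fromℕ≡·1# (suc n) = ≡.cong (1# +_) (fromℕ≡·1# n)

  natMultiple-≉0 : Char0 R → ∀ {x P} → NatMultiple x P → P → ¬ x ≈ 0#
  natMultiple-≉0 char0 (zero  , _    , pos) p _   = contradiction (pos p) λ ()
  natMultiple-≉0 char0 (suc N , x≈N , _)   _ x≈0 =
    char0 N (trans (reflexive (fromℕ≡·1# (suc N))) (trans (sym x≈N) x≈0))

  module _ (κ : Carrier) where

    ΦF-vanishes : ∀ {I j} → ReductionClosed I → (∀ {k} → PureIn I k → j ≢ k) →
                  ∀ f l m n → I l m n → ΦF R κ f l m n j ≈ 0#
    ΦF-vanishes {I} {j} closed j∉pure = go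
      where
      open ReductionClosed closed
      go : ∀ f l m n → I l m n → ΦF R κ f l m n j ≈ 0#
      go f       l       zero    zero    i = X^-off (j∉pure (inj₁ i))
      go f       zero    (suc m) zero    i = X^-off (j∉pure (inj₂ (inj₁ i)))
      go f       zero    zero    (suc n) i = X^-off (j∉pure (inj₂ (inj₂ i)))
      go zero    (suc l) (suc m) n       _ = refl
      go zero    (suc l) zero    (suc n) _ = refl
      go zero    zero    (suc m) (suc n) _ = refl
      go (suc f) (suc l) (suc m) (suc n) i =
        +-vanishes (+-vanishes (+-vanishes (go f (suc (suc l)) m n (xyz→x² i))
                                           (go f l (suc (suc m)) n (xyz→y² i)))
                               (go f l m (suc (suc n)) (xyz→z² i)))
                   (-‿vanishes (*-vanishes κ (go f l m n (xyz→κ i))))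
      go (suc f) zero    (suc m) (suc n) i = *-vanishes _ (go f 1 m n (yz→x i))
      go (suc f) (suc l) zero    (suc n) i = *-vanishes _ (go f l 1 n (xz→y i))
      go (suc f) (suc l) (suc m) zero    i = *-vanishes _ (go f l m 1 (xy→z i))

    ΦF-degree≤δ : ∀ f l m n → DegLE R (ΦF R κ f l m n) (δ l m n)
    ΦF-degree≤δ f l m n i δ<i =
      ΦF-vanishes (δ≤-closed (δ l m n)) (λ pure → >⇒≢ (≤-<-trans (δ≤-pure pure) δ<i)) f l m n ≤-refl

    ΦF-even : ∀ f l m n → SameParity l m n → EvenPoly R (ΦF R κ f l m n)
    ΦF-even f l m n sp i =
      ΦF-vanishes sameParity-closed (λ {k} pure → k%2≡0⇒1+2*i≢k i (sameParity-pure {k} pure)) f l m n sp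

    ΦF-odd : ∀ f l m n → ¬ SameParity l m n → OddPoly R (ΦF R κ f l m n)
    ΦF-odd f l m n ¬sp i =
      ΦF-vanishes ¬sameParity-closed (λ {k} pure → k%2≢0⇒2*i≢k i (¬sameParity-pure {k} pure)) f l m n ¬sp

    -- Stated for every d ≥ δ so that the summands whose δ drops below d contribute the multiple 0.
    ΦF-top-coefficient : ∀ f l m n → SameParity l m n → l ℕ.+ m ℕ.+ n ≤ f →
                         ∀ d → δ l m n ≤ d → NatMultiple (ΦF R κ f l m n d) (d ≡ δ l m n)
    ΦF-top-coefficient f l zero zero _ _ d _ =
      natMultiple-weaken (λ e → ≡.trans e (δ-x^ l)) (X^-natMultiple l d)
    ΦF-top-coefficient f zero (suc m) zero _ _ d _ =
      natMultiple-weaken (λ e → ≡.trans e (δ-y^ (suc m))) (X^-natMultiple (suc m) d)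
    ΦF-top-coefficient f zero zero (suc n) _ _ d _ =
      natMultiple-weaken (λ e → ≡.trans e (δ-z^ (suc n))) (X^-natMultiple (suc n) d)
    ΦF-top-coefficient zero (suc l) (suc m) n       _ () _ _
    ΦF-top-coefficient zero (suc l) zero    (suc n) _ () _ _
    ΦF-top-coefficient zero zero    (suc m) (suc n) _ () _ _
    ΦF-top-coefficient (suc f) (suc l) (suc m) (suc n) sp fuel d δ≤d =
      natMultiple-respects (y≈0⇒x+y≈x (-‿vanishes (*-vanishes κ κ-term≈0)))
        (natMultiple-weaken (λ e → Sum.map (Sum.map (≡.trans e) (≡.trans e)) (≡.trans e) (δ-raise-max l m n))
          (natMultiple-+ (natMultiple-+ x² y²) z²))
      where
      sp′ : SameParity l m n
      sp′ = Equivalence.to (sameParity-suc l m n) sp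
      κ-term≈0 : ΦF R κ f l m n d ≈ 0#
      κ-term≈0 = ΦF-degree≤δ f l m n d (<-≤-trans (δ-lower l m n) δ≤d)
      x² : NatMultiple (ΦF R κ f (suc (suc l)) m n d) (d ≡ δ (suc (suc l)) m n)
      x² = ΦF-top-coefficient f (suc (suc l)) m n sp′ (fuel-xyz→x² fuel) d (≤-trans (δ-raiseˣ l m n) δ≤d)
      y² : NatMultiple (ΦF R κ f l (suc (suc m)) n d) (d ≡ δ l (suc (suc m)) n)
      y² = ΦF-top-coefficient f l (suc (suc m)) n sp′ (fuel-xyz→y² fuel) d (≤-trans (δ-raiseʸ l m n) δ≤d)
      z² : NatMultiple (ΦF R κ f l m (suc (suc n)) d) (d ≡ δ l m (suc (suc n)))
      z² = ΦF-top-coefficient f l m (suc (suc n)) sp′ (fuel-xyz→z² fuel) d (≤-trans (δ-raiseᶻ l m n) δ≤d)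
    ΦF-top-coefficient (suc f) zero (suc m) (suc n) sp fuel d δ≤d =
      natMultiple-double (natMultiple-weaken (λ e → ≡.trans e (δ-yz→x-≡ m n sp′))
        (ΦF-top-coefficient f 1 m n sp′ (fuel-yz→x fuel) d (≤-trans (δ-yz→x m n) δ≤d)))
      where
      sp′ : SameParity 1 m n
      sp′ = Equivalence.to (sameParity-suc 1 m n) sp
    ΦF-top-coefficient (suc f) (suc l) zero (suc n) sp fuel d δ≤d =
      natMultiple-double (natMultiple-weaken (λ e → ≡.trans e (δ-xz→y-≡ l n sp′))
        (ΦF-top-coefficient f l 1 n sp′ (fuel-xz→y fuel) d (≤-trans (δ-xz→y l n) δ≤d)))
      where
      sp′ : SameParity l 1 n
      sp′ = Equivalence.to (sameParity-suc l 1 n) sp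
    ΦF-top-coefficient (suc f) (suc l) (suc m) zero sp fuel d δ≤d =
      natMultiple-double (natMultiple-weaken (λ e → ≡.trans e (δ-xy→z-≡ l m sp′))
        (ΦF-top-coefficient f l m 1 sp′ (fuel-xy→z fuel) d (≤-trans (δ-xy→z l m) δ≤d)))
      where
      sp′ : SameParity l m 1
      sp′ = Equivalence.to (sameParity-suc l m 1) sp

open import Data.Nat using (_+_)

proposition5p1 : ∀ {c ℓ} (R : CommutativeRing c ℓ) → IsIntegralDomain R → CharNot2 R →
    (κ : CommutativeRing.Carrier R) → (l m n : ℕ) →
    DegLE R (Φ R κ l m n) ((l ⊔ m ⊔ n) + (l ⊓ m ⊓ n))
    × (SameParity l m n → Char0 R → DegEq R (Φ R κ l m n) ((l ⊔ m ⊔ n) + (l ⊓ m ⊓ n)))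
    × (SameParity l m n → EvenPoly R (Φ R κ l m n))
    × (¬ SameParity l m n → OddPoly R (Φ R κ l m n))
proposition5p1 R _ _ κ l m n =
  ΦF-degree≤δ R κ fuel l m n ,
  (λ sp char0 → ΦF-degree≤δ R κ fuel l m n ,
                natMultiple-≉0 R char0 (ΦF-top-coefficient R κ fuel l m n sp ≤-refl (δ l m n) ≤-refl) ≡.refl) ,
  ΦF-even R κ fuel l m n ,
  ΦF-odd R κ fuel l m n
  where
  fuel : ℕ
  fuel = l + m + n
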